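{- Let $R$ be a nonempty word over $\{\bullet,\circ\}$ and $k\ge0$. Then \[ \langle\tau_{R,k}\rangle=\sum_{i\ge1}\binom{\ell(R)-1}{i-1}\langle\phi_{k+i}(y)\rangle\quad\text{and, for every } n\ge0,\quad \left[\frac{y^n}{n!}\right]\langle\tau_{R,k}\rangle=\binom{\ell(R)+n-2}{\ell(R)+k-1}. \]
   Context: Words are finite strings over $\{\bullet,\circ\}$; $\ell(R)$ is the length and $R_i$ the $i$-th symbol. For a word $S$, $(S)$ denotes the multiset of its cyclic shifts. There are indeterminates $g_S$ (words $S$), $f_{(S)}$ (cyclic binary strings) and $y$. Define $C'=\sum_{R}\big(\sum_{2\le i\le\ell(R)} g_{R_1\cdots R_i}f_{(R_1R_{i+1}\cdots R_{\ell(R)})}\big)\frac{\partial}{\partial g_R}$ ($R$ over nonempty words). For $i\ge1$, $\phi(v,x_1,\dots,x_i)=\sum_{n\ge i}h_{n-i}(x_1,\dots,x_i)\frac{v^n}{n!}$ ($h_j$ complete homogeneous symmetric polynomial), $\phi(v)=1$; $\phi_i(y)$ is $\phi(y,x_1,\dots,x_i)$ with all $x_j=f_{(\bullet)}$. $\tau_{R,k}$ is the unique solution of $\big(\frac{\partial}{\partial y}-C'\big)\tau_{R,k}=g_{\bullet R}\phi_k(y)$ with $\tau_{R,k}|_{y=0}=0$. For a series $F$, $\langle F\rangle$ is obtained by setting all $g_S$ and $f_{(S)}$ equal to $1$; $[y^n/n!]F$ means $n![y^n]F$. Binomial coefficients $\binom{m}{j}$ are $0$ unless $0\le j\le m$.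 -}

module Defs where

open import Data.Nat as ℕ using (ℕ; zero; suc; _∸_; _<ᵇ_)
open import Data.Nat.Combinatorics using (_C_)
open import Data.Integer as ℤ using (ℤ; +_; -[1+_])
open import Data.List using (List; []; _∷_; length; take; drop; replicate)
open import Data.Bool using (if_then_else_)

data Sym : Set where
  ● ○ : Sym

Word : Set
Word = List Sym

-- Indeterminates: g S for words S, and f S for the cyclic string (S)
-- (a cyclic string is represented by any of its linear representatives S).
data Var : Set where
  g : Word → Var
  f : Word → Var

infixl 6 _⊕_
infixl 7 _⊗_
data Expr : Set where
  const : ℤ → Expr
  var   : Var → Expr
  _⊕_   : Expr → Expr → Expr
  _⊗_   : Expr → Expr → Expr

𝟘 𝟙 : Expr
𝟘 = const (+ 0)
𝟙 = const (+ 1)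

_^ᵉ_ : Expr → ℕ → Expr
x ^ᵉ zero  = 𝟙
x ^ᵉ suc a = x ⊗ (x ^ᵉ a)

sumE : ℕ → (ℕ → Expr) → Expr
sumE zero    F = F 0
sumE (suc j) F = sumE j F ⊕ F (suc j)

-- C' on a single generator g_R :  Σ_{2≤i≤ℓ(R)} g_{R_1⋯R_i} f_{(R_1 R_{i+1}⋯R_ℓ(R))}
-- (empty sum for R = [] ).
C'g-from : ℕ → ℕ → Word → Expr
C'g-from i zero    R        = 𝟘
C'g-from i (suc m) []       = 𝟘
C'g-from i (suc m) (r ∷ rs) =
  (var (g (take i (r ∷ rs))) ⊗ var (f (r ∷ drop i (r ∷ rs)))) ⊕ C'g-from (suc i) m (r ∷ rs)

C'g : Word → Expr
C'g R = C'g-from 2 (length R ∸ 1) R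

C' : Expr → Expr
C' (const c)       = 𝟘
C' (var (g R))     = C'g R
C' (var (f S))     = 𝟘
C' (a ⊕ b)         = C' a ⊕ C' b
C' (a ⊗ b)         = (C' a ⊗ b) ⊕ (a ⊗ C' b)

h : ℕ → List Expr → Expr
h zero    []       = 𝟙
h (suc j) []       = 𝟘
h j       (x ∷ xs) = sumE j (λ a → (x ^ᵉ a) ⊗ h (j ∸ a) xs)

-- [v^n/n!] φ(v, x_1,…,x_i) = h_{n-i}(x_1,…,x_i) if n ≥ i, else 0;
-- [v^n/n!] φ(v) = [n = 0].
φCoeff : List Expr → ℕ → Expr
φCoeff []         zero    = 𝟙
φCoeff []         (suc n) = 𝟘
φCoeff xs@(_ ∷ _) n       = if n <ᵇ length xs then 𝟘 else h (n ∸ length xs) xs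

-- [y^n/n!] φ_i(y): all x_j := f_(●)
φ : ℕ → ℕ → Expr
φ i n = φCoeff (replicate i (var (f (● ∷ [])))) n

-- Power series in y are represented by their sequences of coefficients [y^n/n!].
-- τ_{R,k}: unique solution of (∂/∂y − C') τ = g_{●R} φ_k(y), τ|_{y=0} = 0,
-- i.e. coefficientwise  τ_0 = 0,  τ_{n+1} = C' τ_n + g_{●R} [y^n/n!]φ_k(y).
τ : Word → ℕ → ℕ → Expr
τ R k zero    = 𝟘
τ R k (suc n) = C' (τ R k n) ⊕ (var (g (● ∷ R)) ⊗ φ k n)

⟨_⟩ : Expr → ℤ
⟨ const c ⟩ = c
⟨ var v   ⟩ = + 1
⟨ a ⊕ b   ⟩ = ⟨ a ⟩ ℤ.+ ⟨ b ⟩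
⟨ a ⊗ b   ⟩ = ⟨ a ⟩ ℤ.* ⟨ b ⟩

Σ₁ : ℕ → (ℕ → ℤ) → ℤ
Σ₁ zero    F = + 0
Σ₁ (suc m) F = Σ₁ m F ℤ.+ F (suc m)

-- binomial coefficient with integer top, 0 unless 0 ≤ j ≤ m
binom : ℤ → ℕ → ℤ
binom (+ m)    j = + (m C j)
binom -[1+ _ ] j = + 0

-- Evaluation ⟨_⟩ does not commute with C', but the values ⟨C'^j e⟩ are computable:
-- the f's (hence the φ_k) contain no g and are killed by C' after evaluation, while
-- ⟨C'^(j+1) g_S⟩ is the sum of ⟨C'^j g_T⟩ over the prefixes T of S of length ≥ 2.
-- Replacing g_{●R} by an arbitrary g_S in the defining equation of τ, the solution
-- σ_S therefore satisfies ⟨σ_S⟩(n+1) = Σ_T ⟨σ_T⟩(n) + ⟨φ_k⟩(n); by induction on n it depends only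
-- on ℓ(S), and Pascal's rule gives ⟨σ_S⟩(n+1) = C(ℓ(S)-2+n, ℓ(S)-2+k).  The hockey
-- stick identity gives ⟨φ_{k+1}⟩(n+1) = C(n, k), so the first identity of the theorem
-- is the Chu–Vandermonde convolution Σ_j C(p, j) C(n, k+j) = C(p+n, p+k).

module Submission where

open import Defs
open import Data.Nat using (ℕ; _+_; _∸_)
open import Data.Nat.Combinatorics using (_C_)
open import Data.Integer using (+_; _*_; _-_)
open import Data.List using (length; [])
open import Data.Product using (_×_)
open import Relation.Binary.PropositionalEquality using (_≡_; _≢_)

open import Data.Nat using (zero; suc; _≤_; _<_; _<ᵇ_; z≤n; s≤s)
import Data.Nat.Properties as ℕ
open import Data.Nat.GeneralisedArithmetic using (iterate)
open import Data.Nat.Combinatorics using (nCn≡1; k>n⇒nCk≡0; nCk+nC[k+1]≡[n+1]C[k+1])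
open import Data.Integer as ℤ using (ℤ)
import Data.Integer.Properties as ℤ
open import Data.List using (List; _∷_; take; replicate)
open import Data.List.Properties using (length-take; length-replicate)
open import Data.List.Relation.Unary.All using (All; []; _∷_)
open import Data.List.Relation.Unary.All.Properties using (replicate⁺)
open import Data.Bool using (true; false; if_then_else_)
open import Data.Empty using (⊥-elim)
open import Data.Product using (_,_)
open import Relation.Nullary.Reflects using (ofʸ; ofⁿ)
open import Relation.Binary.PropositionalEquality using (refl; sym; trans; cong; cong₂; module ≡-Reasoning)
open import Algebra.Properties.CommutativeSemigroup ℤ.+-commutativeSemigroup
  using (interchange; xy∙z≈xz∙y; x∙yz≈y∙xz)
open ≡-Reasoning

∑ : ℕ → (ℕ → ℤ) → ℤ
∑ zero    F = + 0
∑ (suc m) F = F 0 ℤ.+ ∑ m (λ a → F (suc a))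

syntax ∑ m (λ a → F) = ∑[ a < m ] F

∑-cong-< : ∀ m {F G : ℕ → ℤ} → (∀ a → a < m → F a ≡ G a) → ∑ m F ≡ ∑ m G
∑-cong-< zero    eq = refl
∑-cong-< (suc m) eq = cong₂ ℤ._+_ (eq 0 (s≤s z≤n)) (∑-cong-< m (λ a a<m → eq (suc a) (s≤s a<m)))

∑-cong : ∀ m {F G : ℕ → ℤ} → (∀ a → F a ≡ G a) → ∑ m F ≡ ∑ m G
∑-cong m eq = ∑-cong-< m (λ a _ → eq a)

∑-zero : ∀ m → ∑ m (λ _ → + 0) ≡ + 0
∑-zero zero    = refl
∑-zero (suc m) = trans (ℤ.+-identityˡ _) (∑-zero m)

∑-distrib-+ : ∀ m (F G : ℕ → ℤ) → ∑[ a < m ] (F a ℤ.+ G a) ≡ ∑ m F ℤ.+ ∑ m G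
∑-distrib-+ zero    F G = refl
∑-distrib-+ (suc m) F G = begin
  F 0 ℤ.+ G 0 ℤ.+ ∑[ a < m ] (F (suc a) ℤ.+ G (suc a))
    ≡⟨ cong (ℤ._+_ (F 0 ℤ.+ G 0)) (∑-distrib-+ m _ _) ⟩
  F 0 ℤ.+ G 0 ℤ.+ (∑[ a < m ] F (suc a) ℤ.+ ∑[ a < m ] G (suc a))
    ≡⟨ interchange (F 0) (G 0) _ _ ⟩
  F 0 ℤ.+ ∑[ a < m ] F (suc a) ℤ.+ (G 0 ℤ.+ ∑[ a < m ] G (suc a)) ∎

*-distribʳ-∑ : ∀ m (F : ℕ → ℤ) c → ∑ m F * c ≡ ∑[ a < m ] (F a * c)
*-distribʳ-∑ zero    F c = ℤ.*-zeroˡ c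
*-distribʳ-∑ (suc m) F c =
  trans (ℤ.*-distribʳ-+ c (F 0) _) (cong (ℤ._+_ (F 0 * c)) (*-distribʳ-∑ m (λ a → F (suc a)) c))

∑-init-last : ∀ m (F : ℕ → ℤ) → ∑ (suc m) F ≡ ∑ m F ℤ.+ F m
∑-init-last zero    F = trans (ℤ.+-identityʳ (F 0)) (sym (ℤ.+-identityˡ (F 0)))
∑-init-last (suc m) F = begin
  F 0 ℤ.+ ∑ (suc m) (λ a → F (suc a))
    ≡⟨ cong (ℤ._+_ (F 0)) (∑-init-last m (λ a → F (suc a))) ⟩
  F 0 ℤ.+ (∑[ a < m ] F (suc a) ℤ.+ F (suc m))
    ≡⟨ sym (ℤ.+-assoc (F 0) _ _) ⟩
  F 0 ℤ.+ ∑[ a < m ] F (suc a) ℤ.+ F (suc m) ∎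

Σ₁≡∑ : ∀ m (F : ℕ → ℤ) → Σ₁ m F ≡ ∑[ a < m ] F (suc a)
Σ₁≡∑ zero    F = refl
Σ₁≡∑ (suc m) F =
  trans (cong (λ s → s ℤ.+ F (suc m)) (Σ₁≡∑ m F)) (sym (∑-init-last m (λ a → F (suc a))))

pascal : ∀ n k → + (n C k) ℤ.+ + (n C suc k) ≡ + (suc n C suc k)
pascal n k = trans (sym (ℤ.pos-+ (n C k) (n C suc k))) (cong +_ (nCk+nC[k+1]≡[n+1]C[k+1] n k))

hockey-stick : ∀ j m → ∑[ a < suc j ] (+ ((j ∸ a + m) C m)) ≡ + ((j + suc m) C suc m)
hockey-stick zero    m = trans (ℤ.+-identityʳ _) (cong +_ (trans (nCn≡1 m) (sym (nCn≡1 (suc m)))))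
hockey-stick (suc j) m = begin
  + ((suc j + m) C m) ℤ.+ ∑[ a < suc j ] (+ ((j ∸ a + m) C m))
    ≡⟨ cong₂ ℤ._+_ (cong (λ l → + (l C m)) (sym (ℕ.+-suc j m))) (hockey-stick j m) ⟩
  + ((j + suc m) C m) ℤ.+ + ((j + suc m) C suc m)
    ≡⟨ pascal (j + suc m) m ⟩
  + ((suc j + suc m) C suc m) ∎

vandermonde : ∀ p n k → ∑[ j < suc p ] (+ (p C j) * + (n C (k + j))) ≡ + ((p + n) C (p + k))
vandermonde zero    n k =
  trans (ℤ.+-identityʳ (+ 1 * + (n C (k + 0))))
        (trans (ℤ.*-identityˡ (+ (n C (k + 0)))) (cong (λ l → + (n C l)) (ℕ.+-identityʳ k)))
vandermonde (suc p) n k = begin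
  ∑[ j < suc (suc p) ] (+ (suc p C j) * + (n C (k + j)))
    ≡⟨ cong (ℤ._+_ (P 0)) (∑-cong (suc p) split) ⟩
  P 0 ℤ.+ ∑[ j < suc p ] (A j ℤ.+ P (suc j))
    ≡⟨ cong (ℤ._+_ (P 0)) (∑-distrib-+ (suc p) A (λ j → P (suc j))) ⟩
  P 0 ℤ.+ (∑ (suc p) A ℤ.+ ∑[ j < suc p ] P (suc j))
    ≡⟨ x∙yz≈y∙xz (P 0) (∑ (suc p) A) (∑[ j < suc p ] P (suc j)) ⟩
  ∑ (suc p) A ℤ.+ ∑ (suc (suc p)) P
    ≡⟨ cong₂ ℤ._+_ (vandermonde p n (suc k)) (trans drop-last (vandermonde p n k)) ⟩
  + ((p + n) C (p + suc k)) ℤ.+ + ((p + n) C (p + k))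
    ≡⟨ cong (λ l → + ((p + n) C l) ℤ.+ + ((p + n) C (p + k))) (ℕ.+-suc p k) ⟩
  + ((p + n) C suc (p + k)) ℤ.+ + ((p + n) C (p + k))
    ≡⟨ ℤ.+-comm (+ ((p + n) C suc (p + k))) (+ ((p + n) C (p + k))) ⟩
  + ((p + n) C (p + k)) ℤ.+ + ((p + n) C suc (p + k))
    ≡⟨ pascal (p + n) (p + k) ⟩
  + ((suc p + n) C (suc p + k)) ∎
  where
  P A : ℕ → ℤ
  P j = + (p C j) * + (n C (k + j))
  A j = + (p C j) * + (n C (suc k + j))
  split : ∀ j → + (suc p C suc j) * + (n C (k + suc j)) ≡ A j ℤ.+ P (suc j)
  split j = begin
    + (suc p C suc j) * + (n C (k + suc j))
      ≡⟨ cong (_* + (n C (k + suc j))) (sym (pascal p j)) ⟩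
    (+ (p C j) ℤ.+ + (p C suc j)) * + (n C (k + suc j))
      ≡⟨ ℤ.*-distribʳ-+ (+ (n C (k + suc j))) (+ (p C j)) (+ (p C suc j)) ⟩
    + (p C j) * + (n C (k + suc j)) ℤ.+ P (suc j)
      ≡⟨ cong (λ l → + (p C j) * + (n C l) ℤ.+ P (suc j)) (ℕ.+-suc k j) ⟩
    A j ℤ.+ P (suc j) ∎
  drop-last : ∑ (suc (suc p)) P ≡ ∑ (suc p) P
  drop-last = begin
    ∑ (suc (suc p)) P
      ≡⟨ ∑-init-last (suc p) P ⟩
    ∑ (suc p) P ℤ.+ + (p C suc p) * + (n C (k + suc p))
      ≡⟨ cong (λ z → ∑ (suc p) P ℤ.+ + z * + (n C (k + suc p))) (k>n⇒nCk≡0 (ℕ.n<1+n p)) ⟩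
    ∑ (suc p) P ℤ.+ + 0
      ≡⟨ ℤ.+-identityʳ (∑ (suc p) P) ⟩
    ∑ (suc p) P ∎

data GFree : Expr → Set where
  const : ∀ c → GFree (const c)
  var-f : ∀ S → GFree (var (f S))
  _⊕_   : ∀ {a b} → GFree a → GFree b → GFree (a ⊕ b)
  _⊗_   : ∀ {a b} → GFree a → GFree b → GFree (a ⊗ b)

C'-GFree : ∀ {e} → GFree e → GFree (C' e)
C'-GFree (const c) = const _
C'-GFree (var-f S) = const _
C'-GFree (a ⊕ b)   = C'-GFree a ⊕ C'-GFree b
C'-GFree (a ⊗ b)   = (C'-GFree a ⊗ b) ⊕ (a ⊗ C'-GFree b)

⟨C'⟩-GFree : ∀ {e} → GFree e → ⟨ C' e ⟩ ≡ + 0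
⟨C'⟩-GFree (const c) = refl
⟨C'⟩-GFree (var-f S) = refl
⟨C'⟩-GFree (a ⊕ b) rewrite ⟨C'⟩-GFree a | ⟨C'⟩-GFree b = refl
⟨C'⟩-GFree {x ⊗ y} (a ⊗ b) rewrite ⟨C'⟩-GFree a | ⟨C'⟩-GFree b | ℤ.*-zeroʳ ⟨ x ⟩ = refl

⟨C'^_⟩ : ℕ → Expr → ℤ
⟨C'^ j ⟩ e = ⟨ iterate C' e j ⟩

⟨C'^⟩-⊕ : ∀ j a b → ⟨C'^ j ⟩ (a ⊕ b) ≡ ⟨C'^ j ⟩ a ℤ.+ ⟨C'^ j ⟩ b
⟨C'^⟩-⊕ zero    a b = refl
⟨C'^⟩-⊕ (suc j) a b = ⟨C'^⟩-⊕ j (C' a) (C' b)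

⟨C'^⟩-𝟘 : ∀ j → ⟨C'^ j ⟩ 𝟘 ≡ + 0
⟨C'^⟩-𝟘 zero    = refl
⟨C'^⟩-𝟘 (suc j) = ⟨C'^⟩-𝟘 j

-- Leibniz: C' b contributes nothing once evaluated, since b is g-free.
⟨C'^⟩-⊗-GFree : ∀ j a {b} → GFree b → ⟨C'^ j ⟩ (a ⊗ b) ≡ ⟨C'^ j ⟩ a * ⟨ b ⟩
⟨C'^⟩-⊗-GFree zero    a         gb = refl
⟨C'^⟩-⊗-GFree (suc j) a {b} gb = begin
  ⟨C'^ j ⟩ ((C' a ⊗ b) ⊕ (a ⊗ C' b))
    ≡⟨ ⟨C'^⟩-⊕ j _ _ ⟩
  ⟨C'^ j ⟩ (C' a ⊗ b) ℤ.+ ⟨C'^ j ⟩ (a ⊗ C' b)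
    ≡⟨ cong₂ ℤ._+_ (⟨C'^⟩-⊗-GFree j (C' a) gb) (⟨C'^⟩-⊗-GFree j a (C'-GFree gb)) ⟩
  ⟨C'^ suc j ⟩ a * ⟨ b ⟩ ℤ.+ ⟨C'^ j ⟩ a * ⟨ C' b ⟩
    ≡⟨ cong (λ z → ⟨C'^ suc j ⟩ a * ⟨ b ⟩ ℤ.+ ⟨C'^ j ⟩ a * z) (⟨C'⟩-GFree gb) ⟩
  ⟨C'^ suc j ⟩ a * ⟨ b ⟩ ℤ.+ ⟨C'^ j ⟩ a * + 0
    ≡⟨ cong (ℤ._+_ (⟨C'^ suc j ⟩ a * ⟨ b ⟩)) (ℤ.*-zeroʳ (⟨C'^ j ⟩ a)) ⟩
  ⟨C'^ suc j ⟩ a * ⟨ b ⟩ ℤ.+ + 0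
    ≡⟨ ℤ.+-identityʳ _ ⟩
  ⟨C'^ suc j ⟩ a * ⟨ b ⟩ ∎

⟨C'^⟩-C'g-from : ∀ j i m r rs →
  ⟨C'^ j ⟩ (C'g-from i m (r ∷ rs)) ≡ ∑[ a < m ] ⟨C'^ j ⟩ (var (g (take (i + a) (r ∷ rs))))
⟨C'^⟩-C'g-from j i zero    r rs = ⟨C'^⟩-𝟘 j
⟨C'^⟩-C'g-from j i (suc m) r rs = begin
  ⟨C'^ j ⟩ ((gᵢ i ⊗ var (f _)) ⊕ C'g-from (suc i) m (r ∷ rs))
    ≡⟨ ⟨C'^⟩-⊕ j _ _ ⟩
  ⟨C'^ j ⟩ (gᵢ i ⊗ var (f _)) ℤ.+ ⟨C'^ j ⟩ (C'g-from (suc i) m (r ∷ rs))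
    ≡⟨ cong₂ ℤ._+_ (trans (⟨C'^⟩-⊗-GFree j (gᵢ i) (var-f _)) (ℤ.*-identityʳ (⟨C'^ j ⟩ (gᵢ i))))
                   (⟨C'^⟩-C'g-from j (suc i) m r rs) ⟩
  ⟨C'^ j ⟩ (gᵢ i) ℤ.+ ∑[ a < m ] ⟨C'^ j ⟩ (gᵢ (suc i + a))
    ≡⟨ cong₂ ℤ._+_ (cong (λ l → ⟨C'^ j ⟩ (gᵢ l)) (sym (ℕ.+-identityʳ i)))
                   (∑-cong m (λ a → cong (λ l → ⟨C'^ j ⟩ (gᵢ l)) (sym (ℕ.+-suc i a)))) ⟩
  ⟨C'^ j ⟩ (gᵢ (i + 0)) ℤ.+ ∑[ a < m ] ⟨C'^ j ⟩ (gᵢ (i + suc a)) ∎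
  where
  gᵢ : ℕ → Expr
  gᵢ l = var (g (take l (r ∷ rs)))

⟨C'^⟩-C'g : ∀ j S → ⟨C'^ j ⟩ (C'g S) ≡ ∑[ a < length S ∸ 1 ] ⟨C'^ j ⟩ (var (g (take (2 + a) S)))
⟨C'^⟩-C'g j []       = ⟨C'^⟩-𝟘 j
⟨C'^⟩-C'g j (r ∷ rs) = ⟨C'^⟩-C'g-from j 2 (length rs) r rs

^ᵉ-GFree : ∀ {x} a → GFree x → GFree (x ^ᵉ a)
^ᵉ-GFree zero    gx = const _
^ᵉ-GFree (suc a) gx = gx ⊗ ^ᵉ-GFree a gx

sumE-GFree : ∀ j {F : ℕ → Expr} → (∀ a → GFree (F a)) → GFree (sumE j F)
sumE-GFree zero    gF = gF 0
sumE-GFree (suc j) gF = sumE-GFree j gF ⊕ gF (suc j)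

h-cons : ∀ j x xs → h j (x ∷ xs) ≡ sumE j (λ a → (x ^ᵉ a) ⊗ h (j ∸ a) xs)
h-cons zero    x xs = refl
h-cons (suc j) x xs = refl

h-GFree : ∀ j {xs} → All GFree xs → GFree (h j xs)
h-GFree zero    []                 = const _
h-GFree (suc j) []                 = const _
h-GFree j       {x ∷ xs} (gx ∷ gxs) rewrite h-cons j x xs =
  sumE-GFree j (λ a → ^ᵉ-GFree a gx ⊗ h-GFree (j ∸ a) gxs)

if-GFree : ∀ b {x y} → GFree x → GFree y → GFree (if b then x else y)
if-GFree true  gx gy = gx
if-GFree false gx gy = gy

φCoeff-GFree : ∀ {xs} n → All GFree xs → GFree (φCoeff xs n)
φCoeff-GFree zero    []           = const _
φCoeff-GFree (suc n) []           = const _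
φCoeff-GFree {xs@(_ ∷ _)} n gxs = if-GFree (n <ᵇ length xs) (const _) (h-GFree (n ∸ length xs) gxs)

φ-GFree : ∀ k n → GFree (φ k n)
φ-GFree k n = φCoeff-GFree n (replicate⁺ k (var-f (● ∷ [])))

σ : Word → ℕ → ℕ → Expr
σ S k zero    = 𝟘
σ S k (suc n) = C' (σ S k n) ⊕ (var (g S) ⊗ φ k n)

τ≡σ : ∀ R k n → τ R k n ≡ σ (● ∷ R) k n
τ≡σ R k zero    = refl
τ≡σ R k (suc n) = cong (λ e → C' e ⊕ (var (g (● ∷ R)) ⊗ φ k n)) (τ≡σ R k n)

⟨C'^suc⟩-σ : ∀ k n j S →
  ⟨C'^ suc j ⟩ (σ S k n) ≡ ∑[ a < length S ∸ 1 ] ⟨C'^ j ⟩ (σ (take (2 + a) S) k n)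
⟨C'^suc⟩-σ k zero    j S =
  trans (⟨C'^⟩-𝟘 j) (sym (trans (∑-cong (length S ∸ 1) (λ _ → ⟨C'^⟩-𝟘 j))
                                (∑-zero (length S ∸ 1))))
⟨C'^suc⟩-σ k (suc n) j S = begin
  ⟨C'^ suc j ⟩ (C' (σ S k n) ⊕ (var (g S) ⊗ φ k n))
    ≡⟨ ⟨C'^⟩-⊕ (suc j) (C' (σ S k n)) (var (g S) ⊗ φ k n) ⟩
  ⟨C'^ suc (suc j) ⟩ (σ S k n) ℤ.+ ⟨C'^ suc j ⟩ (var (g S) ⊗ φ k n)
    ≡⟨ cong₂ ℤ._+_ (⟨C'^suc⟩-σ k n (suc j) S) (⟨C'^⟩-⊗-GFree (suc j) (var (g S)) (φ-GFree k n)) ⟩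
  ∑[ a < l ] ⟨C'^ suc j ⟩ (σ (T a) k n) ℤ.+ ⟨C'^ j ⟩ (C'g S) * ⟨ φ k n ⟩
    ≡⟨ cong (λ z → ∑[ a < l ] ⟨C'^ suc j ⟩ (σ (T a) k n) ℤ.+ z * ⟨ φ k n ⟩) (⟨C'^⟩-C'g j S) ⟩
  ∑[ a < l ] ⟨C'^ suc j ⟩ (σ (T a) k n) ℤ.+ ∑[ a < l ] ⟨C'^ j ⟩ (var (g (T a))) * ⟨ φ k n ⟩
    ≡⟨ cong (ℤ._+_ (∑[ a < l ] ⟨C'^ suc j ⟩ (σ (T a) k n))) (*-distribʳ-∑ l _ _) ⟩
  ∑[ a < l ] ⟨C'^ suc j ⟩ (σ (T a) k n) ℤ.+ ∑[ a < l ] (⟨C'^ j ⟩ (var (g (T a))) * ⟨ φ k n ⟩)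
    ≡⟨ sym (∑-distrib-+ l _ _) ⟩
  ∑[ a < l ] (⟨C'^ suc j ⟩ (σ (T a) k n) ℤ.+ ⟨C'^ j ⟩ (var (g (T a))) * ⟨ φ k n ⟩)
    ≡⟨ ∑-cong l (λ a → sym (trans (⟨C'^⟩-⊕ j _ _)
                                 (cong (ℤ._+_ (⟨C'^ suc j ⟩ (σ (T a) k n)))
                                       (⟨C'^⟩-⊗-GFree j (var (g (T a))) (φ-GFree k n))))) ⟩
  ∑[ a < l ] ⟨C'^ j ⟩ (σ (T a) k (suc n)) ∎
  where
  l = length S ∸ 1
  T : ℕ → Word
  T a = take (2 + a) S

⟨σ⟩-suc : ∀ k n S →
  ⟨ σ S k (suc n) ⟩ ≡ ∑[ a < length S ∸ 1 ] ⟨ σ (take (2 + a) S) k n ⟩ ℤ.+ ⟨ φ k n ⟩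
⟨σ⟩-suc k n S = cong₂ ℤ._+_ (⟨C'^suc⟩-σ k n 0 S) (ℤ.*-identityˡ _)

sumE-value : ∀ j (F : ℕ → Expr) → ⟨ sumE j F ⟩ ≡ ∑[ a < suc j ] ⟨ F a ⟩
sumE-value zero    F = sym (ℤ.+-identityʳ _)
sumE-value (suc j) F =
  trans (cong (λ s → s ℤ.+ ⟨ F (suc j) ⟩) (sumE-value j F))
        (sym (∑-init-last (suc j) (λ a → ⟨ F a ⟩)))

⟨^ᵉ⟩-one : ∀ x a → ⟨ x ⟩ ≡ + 1 → ⟨ x ^ᵉ a ⟩ ≡ + 1
⟨^ᵉ⟩-one x zero    x≡1 = refl
⟨^ᵉ⟩-one x (suc a) x≡1 = cong₂ _*_ x≡1 (⟨^ᵉ⟩-one x a x≡1)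

⟨h⟩-cons : ∀ j x xs → ⟨ x ⟩ ≡ + 1 → ⟨ h j (x ∷ xs) ⟩ ≡ ∑[ a < suc j ] ⟨ h (j ∸ a) xs ⟩
⟨h⟩-cons j x xs x≡1 = begin
  ⟨ h j (x ∷ xs) ⟩
    ≡⟨ cong ⟨_⟩ (h-cons j x xs) ⟩
  ⟨ sumE j (λ a → (x ^ᵉ a) ⊗ h (j ∸ a) xs) ⟩
    ≡⟨ sumE-value j _ ⟩
  ∑[ a < suc j ] (⟨ x ^ᵉ a ⟩ * ⟨ h (j ∸ a) xs ⟩)
    ≡⟨ ∑-cong (suc j) (λ a → cong (_* ⟨ h (j ∸ a) xs ⟩) (⟨^ᵉ⟩-one x a x≡1)) ⟩
  ∑[ a < suc j ] (+ 1 * ⟨ h (j ∸ a) xs ⟩)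
    ≡⟨ ∑-cong (suc j) (λ a → ℤ.*-identityˡ ⟨ h (j ∸ a) xs ⟩) ⟩
  ∑[ a < suc j ] ⟨ h (j ∸ a) xs ⟩ ∎

⟨h⟩-single : ∀ j x → ⟨ x ⟩ ≡ + 1 → ⟨ h j (x ∷ []) ⟩ ≡ + 1
⟨h⟩-single zero    x x≡1 = refl
⟨h⟩-single (suc j) x x≡1 = begin
  ⟨ h (suc j) (x ∷ []) ⟩                   ≡⟨ ⟨h⟩-cons (suc j) x [] x≡1 ⟩
  + 0 ℤ.+ ∑[ a < suc j ] ⟨ h (j ∸ a) [] ⟩   ≡⟨ ℤ.+-identityˡ _ ⟩
  ∑[ a < suc j ] ⟨ h (j ∸ a) [] ⟩           ≡⟨ sym (⟨h⟩-cons j x [] x≡1) ⟩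
  ⟨ h j (x ∷ []) ⟩                         ≡⟨ ⟨h⟩-single j x x≡1 ⟩
  + 1                                      ∎

⟨h⟩-replicate : ∀ j m x → ⟨ x ⟩ ≡ + 1 → ⟨ h j (replicate (suc m) x) ⟩ ≡ + ((j + m) C m)
⟨h⟩-replicate j zero    x x≡1 = ⟨h⟩-single j x x≡1
⟨h⟩-replicate j (suc m) x x≡1 = begin
  ⟨ h j (replicate (suc (suc m)) x) ⟩
    ≡⟨ ⟨h⟩-cons j x (replicate (suc m) x) x≡1 ⟩
  ∑[ a < suc j ] ⟨ h (j ∸ a) (replicate (suc m) x) ⟩
    ≡⟨ ∑-cong (suc j) (λ a → ⟨h⟩-replicate (j ∸ a) m x x≡1) ⟩
  ∑[ a < suc j ] (+ ((j ∸ a + m) C m))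
    ≡⟨ hockey-stick j m ⟩
  + ((j + suc m) C suc m) ∎

-- The coefficient sequence of the answer: Ψ k (ℓ(R) ∸ 1) is ⟨τ_{R,k}⟩, and Ψ k 0 is ⟨φ_{k+1}⟩.
Ψ : ℕ → ℕ → ℕ → ℤ
Ψ k p zero    = + 0
Ψ k p (suc n) = + ((p + n) C (p + k))

⟨φ⟩-suc : ∀ k n → ⟨ φ (suc k) n ⟩ ≡ Ψ k 0 n
⟨φ⟩-suc k zero = refl
⟨φ⟩-suc k (suc n) rewrite length-replicate k {var (f (● ∷ []))} with n <ᵇ k | ℕ.<ᵇ-reflects-< n k
... | true  | ofʸ n<k = cong +_ (sym (k>n⇒nCk≡0 n<k))
... | false | ofⁿ n≮k = trans (⟨h⟩-replicate (n ∸ k) k (var (f (● ∷ []))) refl)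
                             (cong (λ l → + (l C k)) (ℕ.m∸n+n≡m (ℕ.≮⇒≥ n≮k)))

Ψ-pascal : ∀ k p n → Ψ k p (suc n) ℤ.+ Ψ k (suc p) n ≡ Ψ k (suc p) (suc n)
Ψ-pascal k p zero = begin
  + ((p + 0) C (p + k)) ℤ.+ + 0
    ≡⟨ ℤ.+-identityʳ _ ⟩
  + ((p + 0) C (p + k))
    ≡⟨ cong (λ l → + (l C (p + k))) (ℕ.+-identityʳ p) ⟩
  + (p C (p + k))
    ≡⟨ sym (ℤ.+-identityʳ _) ⟩
  + (p C (p + k)) ℤ.+ + 0
    ≡⟨ cong (λ z → + (p C (p + k)) ℤ.+ + z) (sym (k>n⇒nCk≡0 (s≤s (ℕ.m≤m+n p k)))) ⟩
  + (p C (p + k)) ℤ.+ + (p C suc (p + k))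
    ≡⟨ pascal p (p + k) ⟩
  + (suc p C suc (p + k))
    ≡⟨ cong (λ l → + (l C suc (p + k))) (sym (ℕ.+-identityʳ (suc p))) ⟩
  + ((suc p + 0) C suc (p + k)) ∎
Ψ-pascal k p (suc n) =
  trans (cong (λ l → + ((p + suc n) C (p + k)) ℤ.+ + (l C suc (p + k))) (sym (ℕ.+-suc p n)))
        (pascal (p + suc n) (p + k))

∑Ψ+φ : ∀ k n p → ∑[ a < suc p ] Ψ k a n ℤ.+ ⟨ φ k n ⟩ ≡ Ψ k p (suc n)
∑Ψ+φ zero    zero    zero = refl
∑Ψ+φ zero    (suc n) zero = refl
∑Ψ+φ (suc k) zero    zero = refl
∑Ψ+φ (suc k) (suc n) zero = begin
  + (n C suc k) ℤ.+ + 0 ℤ.+ ⟨ φ (suc k) (suc n) ⟩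
    ≡⟨ cong₂ ℤ._+_ (ℤ.+-identityʳ (+ (n C suc k))) (⟨φ⟩-suc k (suc n)) ⟩
  + (n C suc k) ℤ.+ + (n C k)
    ≡⟨ ℤ.+-comm (+ (n C suc k)) (+ (n C k)) ⟩
  + (n C k) ℤ.+ + (n C suc k)
    ≡⟨ pascal n k ⟩
  + (suc n C suc k) ∎
∑Ψ+φ k n (suc p) = begin
  ∑[ a < suc (suc p) ] Ψ k a n ℤ.+ ⟨ φ k n ⟩
    ≡⟨ cong (λ s → s ℤ.+ ⟨ φ k n ⟩) (∑-init-last (suc p) (λ a → Ψ k a n)) ⟩
  ∑[ a < suc p ] Ψ k a n ℤ.+ Ψ k (suc p) n ℤ.+ ⟨ φ k n ⟩
    ≡⟨ xy∙z≈xz∙y (∑[ a < suc p ] Ψ k a n) (Ψ k (suc p) n) ⟨ φ k n ⟩ ⟩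
  ∑[ a < suc p ] Ψ k a n ℤ.+ ⟨ φ k n ⟩ ℤ.+ Ψ k (suc p) n
    ≡⟨ cong (λ s → s ℤ.+ Ψ k (suc p) n) (∑Ψ+φ k n p) ⟩
  Ψ k p (suc n) ℤ.+ Ψ k (suc p) n
    ≡⟨ Ψ-pascal k p n ⟩
  Ψ k (suc p) (suc n) ∎

length-take-≤ : ∀ {A : Set} i (xs : List A) → i ≤ length xs → length (take i xs) ≡ i
length-take-≤ i xs i≤ = trans (length-take i xs) (ℕ.m≤n⇒m⊓n≡m i≤)

⟨σ⟩-closed : ∀ k n p S → length S ≡ 2 + p → ⟨ σ S k n ⟩ ≡ Ψ k p n
⟨σ⟩-closed k zero    p S ℓS = refl
⟨σ⟩-closed k (suc n) p S ℓS = begin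
  ⟨ σ S k (suc n) ⟩
    ≡⟨ ⟨σ⟩-suc k n S ⟩
  ∑[ a < length S ∸ 1 ] ⟨ σ (take (2 + a) S) k n ⟩ ℤ.+ ⟨ φ k n ⟩
    ≡⟨ cong (λ l → ∑[ a < l ∸ 1 ] ⟨ σ (take (2 + a) S) k n ⟩ ℤ.+ ⟨ φ k n ⟩) ℓS ⟩
  ∑[ a < suc p ] ⟨ σ (take (2 + a) S) k n ⟩ ℤ.+ ⟨ φ k n ⟩
    ≡⟨ cong (λ s → s ℤ.+ ⟨ φ k n ⟩) (∑-cong-< (suc p) prefix-closed) ⟩
  ∑[ a < suc p ] Ψ k a n ℤ.+ ⟨ φ k n ⟩
    ≡⟨ ∑Ψ+φ k n p ⟩
  Ψ k p (suc n) ∎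
  where
  prefix-closed : ∀ a → a < suc p → ⟨ σ (take (2 + a) S) k n ⟩ ≡ Ψ k a n
  prefix-closed a a<1+p = ⟨σ⟩-closed k n a (take (2 + a) S)
    (length-take-≤ (2 + a) S
      (ℕ.≤-trans (ℕ.+-monoʳ-≤ 2 (ℕ.≤-pred a<1+p)) (ℕ.≤-reflexive (sym ℓS))))

∑binomial-Ψ : ∀ p k n → ∑[ j < suc p ] (+ (p C j) * Ψ (k + j) 0 n) ≡ Ψ k p n
∑binomial-Ψ p k zero    = trans (∑-cong (suc p) (λ j → ℤ.*-zeroʳ (+ (p C j)))) (∑-zero (suc p))
∑binomial-Ψ p k (suc n) = vandermonde p n k

∑binomial-φ : ∀ p k n → Σ₁ (suc p) (λ i → + (p C (i ∸ 1)) * ⟨ φ (k + i) n ⟩) ≡ Ψ k p n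
∑binomial-φ p k n = begin
  Σ₁ (suc p) (λ i → + (p C (i ∸ 1)) * ⟨ φ (k + i) n ⟩)
    ≡⟨ Σ₁≡∑ (suc p) (λ i → + (p C (i ∸ 1)) * ⟨ φ (k + i) n ⟩) ⟩
  ∑[ j < suc p ] (+ (p C j) * ⟨ φ (k + suc j) n ⟩)
    ≡⟨ ∑-cong (suc p) (λ j → cong (λ l → + (p C j) * ⟨ φ l n ⟩) (ℕ.+-suc k j)) ⟩
  ∑[ j < suc p ] (+ (p C j) * ⟨ φ (suc (k + j)) n ⟩)
    ≡⟨ ∑-cong (suc p) (λ j → cong (+ (p C j) *_) (⟨φ⟩-suc (k + j) n)) ⟩
  ∑[ j < suc p ] (+ (p C j) * Ψ (k + j) 0 n)
    ≡⟨ ∑binomial-Ψ p k n ⟩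
  Ψ k p n ∎

Ψ≡binom : ∀ k p n → Ψ k p n ≡ binom (+ (suc p + n) - + 2) (suc p + k ∸ 1)
Ψ≡binom k zero    zero    = refl
Ψ≡binom k (suc p) zero    = cong +_ (sym (k>n⇒nCk≡0 (s≤s (ℕ.+-monoʳ-≤ p z≤n))))
Ψ≡binom k p       (suc n) rewrite ℕ.+-suc p n = refl

⟨τ⟩-closed : ∀ r rs k n → ⟨ τ (r ∷ rs) k n ⟩ ≡ Ψ k (length rs) n
⟨τ⟩-closed r rs k n =
  trans (cong ⟨_⟩ (τ≡σ (r ∷ rs) k n)) (⟨σ⟩-closed k n (length rs) (● ∷ r ∷ rs) refl)

mainTheorem9 : ∀ (R : Word) → R ≢ [] → ∀ (k : ℕ) →
    (∀ n → ⟨ τ R k n ⟩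
         ≡ Σ₁ (length R) (λ i → + ((length R ∸ 1) C (i ∸ 1)) * ⟨ φ (k + i) n ⟩))
    × (∀ n → ⟨ τ R k n ⟩ ≡ binom (+ (length R + n) - + 2) (length R + k ∸ 1))
mainTheorem9 []       R≢[] k = ⊥-elim (R≢[] refl)
mainTheorem9 (r ∷ rs) _    k =
    (λ n → trans (⟨τ⟩-closed r rs k n) (sym (∑binomial-φ (length rs) k n)))
  , (λ n → trans (⟨τ⟩-closed r rs k n) (Ψ≡binom k (length rs) n))
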